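{- Let $p$ be an odd prime and let $(V,W,\beta)$ be a two-sorted structure where $V$ and $W$ are vector spaces over $\mathbb{F}_p$, each of dimension at least $2$, and $\beta:V\times V\to W$ is bilinear. Let $\chi$ be a first-order sentence expressing this information (for the bound on dimension) and let $\psi$ be the sentence: for all linearly independent $v_1,v_2\in V$ and all $w_1,w_2\in W$ there is $z\in V$ with $\beta(v_1,z)=w_1$ and $\beta(v_2,z)=w_2$. Then $\chi\wedge\psi$ has no finite model.
   Context: Each sort is viewed in the usual language of $\mathbb{F}_p$-modules, with a function symbol for $\beta$. -}

module Defs where

open import Level using (Level; _⊔_)
open import Data.Nat using (ℕ; zero; suc; _<_)
open import Data.Nat.Divisibility using (_∣_)
open import Data.Fin using (Fin)
open import Data.Product using (Σ; ∃; _×_)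
open import Function.Bundles using (_⇔_)
open import Algebra.Bundles using (CommutativeRing)
open import Algebra.Module.Bundles using (Module)

module _ {c ℓ : Level} (F : CommutativeRing c ℓ) where
  open CommutativeRing F

  natToRing : ℕ → Carrier
  natToRing zero    = 0#
  natToRing (suc n) = 1# + natToRing n

  -- F is (isomorphic to) the prime field 𝔽_p = ℤ/pℤ: the canonical ring map
  -- ℤ → F (restricted to ℕ) is surjective, hitting everything already on
  -- {0,…,p-1}, and its kernel is exactly pℤ.
  record IsFp (p : ℕ) : Set (c ⊔ ℓ) where
    field
      surjective : ∀ (x : Carrier) → Σ ℕ λ n → n < p × natToRing n ≈ x
      kernel     : ∀ (n : ℕ) → (natToRing n ≈ 0#) ⇔ (p ∣ n)

module _ {c ℓ m ℓm : Level} {F : CommutativeRing c ℓ} where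
  open CommutativeRing F

  LinIndep₂ : (M : Module F m ℓm) → Module.Carrierᴹ M → Module.Carrierᴹ M → Set (c ⊔ ℓ ⊔ ℓm)
  LinIndep₂ M v₁ v₂ =
    ∀ (a b : Carrier) → (a *ₗ v₁) +ᴹ (b *ₗ v₂) ≈ᴹ 0ᴹ → (a ≈ 0#) × (b ≈ 0#)
    where open Module M

  DimAtLeast2 : (M : Module F m ℓm) → Set (c ⊔ ℓ ⊔ m ⊔ ℓm)
  DimAtLeast2 M = Σ (Module.Carrierᴹ M) λ v₁ → Σ (Module.Carrierᴹ M) λ v₂ → LinIndep₂ M v₁ v₂

  FiniteModule : (M : Module F m ℓm) → Set (m ⊔ ℓm)
  FiniteModule M = Σ ℕ λ n → Σ (Fin n → Carrierᴹ) λ enum → ∀ (x : Carrierᴹ) → ∃ λ i → enum i ≈ᴹ x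
    where open Module M

module _ {c ℓ m ℓm n ℓn : Level} {F : CommutativeRing c ℓ} where
  open CommutativeRing F

  record IsBilinear (V : Module F m ℓm) (W : Module F n ℓn)
                    (β : Module.Carrierᴹ V → Module.Carrierᴹ V → Module.Carrierᴹ W)
                    : Set (c ⊔ m ⊔ ℓm ⊔ ℓn) where
    private
      module V = Module V
      module W = Module W
    field
      cong    : ∀ {u u′ v v′} → u V.≈ᴹ u′ → v V.≈ᴹ v′ → β u v W.≈ᴹ β u′ v′
      +-left  : ∀ u u′ v → β (u V.+ᴹ u′) v W.≈ᴹ (β u v W.+ᴹ β u′ v)
      +-right : ∀ u v v′ → β u (v V.+ᴹ v′) W.≈ᴹ (β u v W.+ᴹ β u v′)
      *-left  : ∀ (a : Carrier) u v → β (a V.*ₗ u) v W.≈ᴹ (a W.*ₗ β u v)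
      *-right : ∀ (a : Carrier) u v → β u (a V.*ₗ v) W.≈ᴹ (a W.*ₗ β u v)

  Psi : (V : Module F m ℓm) (W : Module F n ℓn)
        (β : Module.Carrierᴹ V → Module.Carrierᴹ V → Module.Carrierᴹ W) → Set (c ⊔ ℓ ⊔ m ⊔ ℓm ⊔ n ⊔ ℓn)
  Psi V W β =
    ∀ (v₁ v₂ : V.Carrierᴹ) → LinIndep₂ V v₁ v₂ →
    ∀ (w₁ w₂ : W.Carrierᴹ) →
    Σ V.Carrierᴹ λ z → (β v₁ z W.≈ᴹ w₁) × (β v₂ z W.≈ᴹ w₂)
    where
      module V = Module V
      module W = Module W

-- Fix independent v₁, v₂ ∈ V and w₁, w₂ ∈ W, and let N = |V|, M = |W|, K = ker β(v₁, ·), k = |K|.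
-- By ψ the map β(v₁, ·) : V → W is onto, so N = M k; and for every v outside the line 𝔽ₚ v₁ the map
-- z ↦ (β(v₁, z), β(v, z)) : V → W² is onto, so r(v) = |K ∩ ker β(v, ·)| equals N / M² = k / M.
-- Now count the pairs (v, z) ∈ V × K with β(v, z) = 0 in two ways.  Over v: at most p vectors lie on
-- the line (each contributing at most k), all others contribute k / M.  Over z: z = 0 contributes N,
-- and every other z contributes c(z) = |ker β(·, z)| ≥ N / M.  Hence (M - 1) N ≤ (M - 1) p k, that is
-- N ≤ p k and M ≤ p; but W contains the p + 1 distinct vectors a w₁ (a ∈ 𝔽ₚ) and w₂.
module Submission where

open import Defs
open import Level using (Level; _⊔_)
open import Data.Nat using (ℕ)
open import Relation.Binary.PropositionalEquality using (_≢_)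
open import Data.Nat.Primality using (Prime)
open import Relation.Nullary using (¬_)
open import Algebra.Bundles using (CommutativeRing)
open import Algebra.Module.Bundles using (Module)

open import Algebra.Bundles using (Group)
open import Algebra.Construct.DirectProduct using () renaming (group to _×ᴳ_)
open import Algebra.Morphism.Structures using (module MagmaMorphisms)
import Algebra.Properties.Semiring.Sum as SemiringSum
open import Data.Bool.Base using (if_then_else_)
open import Data.Empty using (⊥)
open import Data.Fin.Base using (Fin; zero; suc; toℕ; fromℕ<; combine; remQuot)
import Data.Fin.Properties as Fin
open import Data.Nat.Base as ℕ
  using (zero; suc; _≤_; _<_; z≤n; s≤s; NonZero; >-nonZero; >-nonZero⁻¹; ≢-nonZero)
import Data.Nat.Properties as ℕₚ
open import Data.Nat.Coprimality using (prime⇒coprime; coprime-Bézout)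
open import Data.Nat.Divisibility using (_∣_; >⇒∤; n∣m*n; ∣1⇒≡1)
open import Data.Nat.GCD using (module Bézout)
open import Data.Nat.Primality using (prime⇒nonZero; prime⇒nonTrivial)
open import Data.Product.Base as Product using (Σ; ∃; _×_; _,_; proj₁; proj₂; uncurry)
open import Data.Product.Relation.Binary.Pointwise.NonDependent using (Pointwise; _×ₛ_)
open import Data.Sum.Base using (inj₁; inj₂)
open import Data.Vec.Functional using (Vector; _∷_)
open import Effect.Monad using (RawMonad)
open import Function.Base using (_∘_; id)
open import Function.Bundles using (Equivalence; mk⇔)
open import Relation.Binary.Bundles using (Setoid)
open import Relation.Binary.Core using (_Preserves_⟶_)
open import Relation.Binary.Definitions using (Decidable)
open import Relation.Binary.PropositionalEquality as ≡ using (_≡_)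
open import Relation.Nullary.Decidable
  using (Dec; yes; no; does; map′; _×-dec_; does-⇔; dec-true; dec-false; ¬¬-excluded-middle)
open import Relation.Nullary.Negation using (contradiction; ¬¬-map; ¬¬-Monad)

open MagmaMorphisms using (IsMagmaHomomorphism)
module Sum = SemiringSum ℕₚ.+-*-semiring

private
  variable
    a b p q ℓ ℓ′ : Level

module FiniteSums where
  open import Data.Nat.Base using (_+_; _*_)
  open ≡ using (cong; cong₂)
  open import Data.Nat.Properties
    using ( +-mono-≤; +-identityʳ; *-identityˡ; *-identityʳ; *-zeroʳ; m≤m+n; m≤n+m; ≤-reflexive; ≤-trans
          ; module ≤-Reasoning)

  𝟙 : {P : Set p} → Dec P → ℕ
  𝟙 d = if does d then 1 else 0

  𝟙-yes : {P : Set p} (d : Dec P) → P → 𝟙 d ≡ 1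
  𝟙-yes d x rewrite dec-true d x = ≡.refl

  𝟙-no : {P : Set p} (d : Dec P) → ¬ P → 𝟙 d ≡ 0
  𝟙-no d ¬x rewrite dec-false d ¬x = ≡.refl

  𝟙-⇔ : {P : Set p} {Q : Set q} → (P → Q) → (Q → P) → (d : Dec P) (e : Dec Q) → 𝟙 d ≡ 𝟙 e
  𝟙-⇔ f g d e = cong (λ b → if b then 1 else 0) (does-⇔ (mk⇔ f g) d e)

  𝟙-×-dec : {P : Set p} {Q : Set q} (d : Dec P) (e : Dec Q) → 𝟙 (d ×-dec e) ≡ 𝟙 d * 𝟙 e
  𝟙-×-dec (yes _) (yes _) = ≡.refl
  𝟙-×-dec (yes _) (no _)  = ≡.refl
  𝟙-×-dec (no _)  _       = ≡.refl

  𝟙≤1 : {P : Set p} (d : Dec P) → 𝟙 d ≤ 1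
  𝟙≤1 (yes _) = s≤s z≤n
  𝟙≤1 (no _)  = z≤n

  sum-mono-≤ : ∀ {n} {f g : Vector ℕ n} → (∀ i → f i ≤ g i) → Sum.sum f ≤ Sum.sum g
  sum-mono-≤ {zero}  _   = z≤n
  sum-mono-≤ {suc n} f≤g = +-mono-≤ (f≤g zero) (sum-mono-≤ (f≤g ∘ suc))

  sum-term : ∀ {n} (f : Vector ℕ n) i → f i ≤ Sum.sum f
  sum-term f zero    = m≤m+n (f zero) _
  sum-term f (suc i) = ≤-trans (sum-term (f ∘ suc) i) (m≤n+m _ (f zero))

  sum-const : ∀ n c → Sum.sum {n} (λ _ → c) ≡ n * c
  sum-const zero    c = ≡.refl
  sum-const (suc n) c = cong (c +_) (sum-const n c)

  sum-select : ∀ {n} (j : Fin n) (f : Vector ℕ n) → Sum.sum (λ i → 𝟙 (i Fin.≟ j) * f i) ≡ f j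
  sum-select {suc n} zero    f = ≡.trans (cong₂ _+_ (*-identityˡ (f zero)) (Sum.sum-replicate-zero n))
                                         (+-identityʳ (f zero))
  sum-select {suc n} (suc j) f = sum-select j (f ∘ suc)

  record Enumeration (S : Setoid a ℓ) : Set (a ⊔ ℓ) where
    open Setoid S
    field
      size           : ℕ
      elem           : Fin size → Carrier
      surjective     : ∀ x → ∃ λ i → elem i ≈ x
      elem-injective : ∀ {i j} → elem i ≈ elem j → i ≡ j

    index : Carrier → Fin size
    index x = proj₁ (surjective x)

    elem-index : ∀ x → elem (index x) ≈ x
    elem-index x = proj₂ (surjective x)

    index-injective : ∀ {x y} → index x ≡ index y → x ≈ y
    index-injective {x} {y} eq = trans (sym (elem-index x)) (trans (reflexive (cong elem eq)) (elem-index y))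

    index-cong : ∀ {x y} → x ≈ y → index x ≡ index y
    index-cong {x} {y} x≈y = elem-injective (trans (elem-index x) (trans x≈y (sym (elem-index y))))

    infix 4 _≟_
    _≟_ : Decidable _≈_
    x ≟ y = map′ index-injective index-cong (index x Fin.≟ index y)

    δ : Carrier → Carrier → ℕ
    δ x y = 𝟙 (x ≟ y)

    δ-congʳ : ∀ x {y y′} → y ≈ y′ → δ x y ≡ δ x y′
    δ-congʳ x y≈y′ = 𝟙-⇔ (λ e → trans e y≈y′) (λ e → trans e (sym y≈y′)) (x ≟ _) (x ≟ _)

    injective⇒≤size : ∀ {m} (f : Fin m → Carrier) → (∀ {i j} → f i ≈ f j → i ≡ j) → m ≤ size
    injective⇒≤size f f-injective = Fin.injective⇒≤ (f-injective ∘ index-injective)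

  ∑ : {S : Setoid a ℓ} → Enumeration S → (Setoid.Carrier S → ℕ) → ℕ
  ∑ E f = Sum.sum (f ∘ Enumeration.elem E)

  syntax ∑ E (λ x → t) = ∑[ x ∈ E ] t

  ∑-comm : {S : Setoid a ℓ} {T : Setoid b ℓ′} (E : Enumeration S) (F : Enumeration T)
           (f : Setoid.Carrier S → Setoid.Carrier T → ℕ) →
           ∑[ x ∈ E ] ∑[ y ∈ F ] f x y ≡ ∑[ y ∈ F ] ∑[ x ∈ E ] f x y
  ∑-comm E F f = Sum.∑-comm (λ i j → f (Enumeration.elem E i) (Enumeration.elem F j))

  module _ {S : Setoid a ℓ} (E : Enumeration S) where
    open Setoid S using (Carrier; _≈_; sym; trans)
    open Enumeration E

    ∑-cong : ∀ {f g : Carrier → ℕ} → (∀ x → f x ≡ g x) → ∑ E f ≡ ∑ E g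
    ∑-cong f≗g = Sum.sum-cong-≗ (f≗g ∘ elem)

    ∑-mono-≤ : ∀ {f g : Carrier → ℕ} → (∀ x → f x ≤ g x) → ∑ E f ≤ ∑ E g
    ∑-mono-≤ f≤g = sum-mono-≤ (f≤g ∘ elem)

    ∑-distrib-+ : ∀ (f g : Carrier → ℕ) → ∑[ x ∈ E ] (f x + g x) ≡ ∑ E f + ∑ E g
    ∑-distrib-+ f g = Sum.∑-distrib-+ (f ∘ elem) (g ∘ elem)

    *-distribˡ-∑ : ∀ c (f : Carrier → ℕ) → c * ∑ E f ≡ ∑[ x ∈ E ] (c * f x)
    *-distribˡ-∑ c f = Sum.*-distribˡ-sum c (f ∘ elem)

    *-distribʳ-∑ : ∀ c (f : Carrier → ℕ) → ∑ E f * c ≡ ∑[ x ∈ E ] (f x * c)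
    *-distribʳ-∑ c f = Sum.*-distribʳ-sum c (f ∘ elem)

    ∑-const : ∀ c → ∑[ _ ∈ E ] c ≡ size * c
    ∑-const = sum-const size

    ∑-term : ∀ {f : Carrier → ℕ} → f Preserves _≈_ ⟶ _≡_ → ∀ x → f x ≤ ∑ E f
    ∑-term {f} f-cong x = ≤-trans (≤-reflexive (f-cong (sym (elem-index x)))) (sum-term (f ∘ elem) (index x))

    ∑-δ : ∀ {g : Carrier → ℕ} → g Preserves _≈_ ⟶ _≡_ → ∀ x → ∑[ y ∈ E ] (δ y x * g y) ≡ g x
    ∑-δ {g} g-cong x = begin
      Sum.sum (λ i → δ (elem i) x * g (elem i))          ≡⟨ Sum.sum-cong-≗ (cong (_* g (elem _)) ∘ δ-elem) ⟩
      Sum.sum (λ i → 𝟙 (i Fin.≟ index x) * g (elem i))  ≡⟨ sum-select (index x) (g ∘ elem) ⟩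
      g (elem (index x))                                ≡⟨ g-cong (elem-index x) ⟩
      g x                                               ∎
      where
      open ≡.≡-Reasoning
      δ-elem : ∀ i → δ (elem i) x ≡ 𝟙 (i Fin.≟ index x)
      δ-elem i = 𝟙-⇔ (λ eq → elem-injective (trans eq (sym (elem-index x))))
                     (λ { ≡.refl → elem-index x }) (elem i ≟ x) (i Fin.≟ index x)

    ∑-δ₁ : ∀ x → ∑[ y ∈ E ] δ y x ≡ 1
    ∑-δ₁ x = ≡.trans (∑-cong (λ y → ≡.sym (*-identityʳ (δ y x)))) (∑-δ (λ _ → ≡.refl) x)

    ∑-reindex : ∀ {g : Carrier → ℕ} → g Preserves _≈_ ⟶ _≡_ → (f f⁻¹ : Carrier → Carrier) →
                (∀ {x y} → x ≈ f y → y ≈ f⁻¹ x) → (∀ {x y} → y ≈ f⁻¹ x → x ≈ f y) →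
                ∑[ y ∈ E ] g (f y) ≡ ∑ E g
    ∑-reindex {g} g-cong f f⁻¹ to from = begin
      ∑[ y ∈ E ] g (f y)
        ≡⟨ ∑-cong (λ y → ≡.sym (∑-δ g-cong (f y))) ⟩
      ∑[ y ∈ E ] ∑[ x ∈ E ] (δ x (f y) * g x)
        ≡⟨ ∑-comm E E (λ y x → δ x (f y) * g x) ⟩
      ∑[ x ∈ E ] ∑[ y ∈ E ] (δ x (f y) * g x)
        ≡⟨ ∑-cong (λ x → ∑-cong (λ y → cong (_* g x) (δ-inverse x y))) ⟩
      ∑[ x ∈ E ] ∑[ y ∈ E ] (δ y (f⁻¹ x) * g x)
        ≡⟨ ∑-cong (λ x → ∑-δ {g = λ _ → g x} (λ _ → ≡.refl) (f⁻¹ x)) ⟩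
      ∑ E g
        ∎
      where
      open ≡.≡-Reasoning
      δ-inverse : ∀ x y → δ x (f y) ≡ δ y (f⁻¹ x)
      δ-inverse x y = 𝟙-⇔ to from (x ≟ f y) (y ≟ f⁻¹ x)

  module _ {G : Group a ℓ} (𝔾 : Enumeration (Group.setoid G)) where
    open Group G
    open import Algebra.Properties.Group G using (//-cong₂; //-rightDividesˡ; //-rightDividesʳ)

    ∑-translate : ∀ {g : Carrier → ℕ} → g Preserves _≈_ ⟶ _≡_ →
                  ∀ c → ∑[ y ∈ 𝔾 ] g (y ∙ c) ≡ ∑ 𝔾 g
    ∑-translate g-cong c = ∑-reindex 𝔾 g-cong (_∙ c) (_// c)
      (λ {x} {y} x≈yc → trans (sym (//-rightDividesʳ c y)) (//-cong₂ (sym x≈yc) refl))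
      (λ {x} {y} y≈x/c → trans (sym (//-rightDividesˡ c x)) (∙-congʳ (sym y≈x/c)))

  module _ {S : Setoid a ℓ} {T : Setoid b ℓ′} where
    private
      module S = Setoid S
      module T = Setoid T
    open Enumeration

    infixr 2 _×ₑ_
    _×ₑ_ : Enumeration S → Enumeration T → Enumeration (S ×ₛ T)
    E ×ₑ F = record
      { size           = size E * size F
      ; elem           = elem-pair ∘ remQuot {size E} (size F)
      ; surjective     = λ (x , y) → combine (index E x) (index F y) , elem-combine x y
      ; elem-injective = λ {k} {l} eq → begin
          k                                              ≡⟨ Fin.combine-remQuot {size E} (size F) k ⟨
          uncurry combine (remQuot {size E} (size F) k)  ≡⟨ cong (uncurry combine) (remQuot-injective eq) ⟩
          uncurry combine (remQuot {size E} (size F) l)  ≡⟨ Fin.combine-remQuot {size E} (size F) l ⟩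
          l                                              ∎
      }
      where
      open ≡.≡-Reasoning
      _≈_ : S.Carrier × T.Carrier → S.Carrier × T.Carrier → Set (ℓ ⊔ ℓ′)
      _≈_ = Pointwise S._≈_ T._≈_
      elem-pair : Fin (size E) × Fin (size F) → S.Carrier × T.Carrier
      elem-pair (i , j) = elem E i , elem F j
      elem-combine : ∀ x y → elem-pair (remQuot (size F) (combine (index E x) (index F y))) ≈ (x , y)
      elem-combine x y = ≡.subst (λ ij → elem-pair ij ≈ (x , y))
                                 (≡.sym (Fin.remQuot-combine (index E x) (index F y)))
                                 (elem-index E x , elem-index F y)
      remQuot-injective : ∀ {k l} → elem-pair (remQuot (size F) k) ≈ elem-pair (remQuot (size F) l) →
                          remQuot {size E} (size F) k ≡ remQuot (size F) l
      remQuot-injective (eq₁ , eq₂) = cong₂ _,_ (elem-injective E eq₁) (elem-injective F eq₂)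

    δ-×ₑ : (E : Enumeration S) (F : Enumeration T) → ∀ x y x′ y′ →
           δ (E ×ₑ F) (x , y) (x′ , y′) ≡ δ E x x′ * δ F y y′
    δ-×ₑ E F x y x′ y′ =
      ≡.trans (𝟙-⇔ id id (_≟_ (E ×ₑ F) (x , y) (x′ , y′)) (_≟_ E x x′ ×-dec _≟_ F y y′))
              (𝟙-×-dec (_≟_ E x x′) (_≟_ F y y′))

  module _ {S : Setoid a ℓ} where
    open Setoid S

    Finite : Set (a ⊔ ℓ)
    Finite = Σ ℕ λ n → Σ (Fin n → Carrier) λ e → ∀ x → ∃ λ i → e i ≈ x

    finite⇒¬¬decidable : Finite → ¬ ¬ Decidable _≈_
    finite⇒¬¬decidable (_ , e , e-surj) =
      ¬¬-map decidable (¬¬-∀ λ i → ¬¬-∀ λ j → ¬¬-excluded-middle)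
      where
      ¬¬-∀ : ∀ {k} {P : Fin k → Set ℓ} → (∀ i → ¬ ¬ P i) → ¬ ¬ (∀ i → P i)
      ¬¬-∀ = Fin.sequence (RawMonad.rawApplicative ¬¬-Monad)
      decidable : (∀ i j → Dec (e i ≈ e j)) → Decidable _≈_
      decidable d x y with e-surj x | e-surj y
      ... | i , eᵢ≈x | j , eⱼ≈y =
        map′ (λ eq → trans (sym eᵢ≈x) (trans eq eⱼ≈y))
             (λ eq → trans eᵢ≈x (trans eq (sym eⱼ≈y))) (d i j)

    private
      record Deduplicated {n} (e : Fin n → Carrier) : Set (a ⊔ ℓ) where
        field
          size           : ℕ
          elem           : Fin size → Carrier
          elem-injective : ∀ {i j} → elem i ≈ elem j → i ≡ j
          covers         : ∀ i → ∃ λ j → elem j ≈ e i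

    module _ (_≟_ : Decidable _≈_) where

      private
        deduplicate : ∀ {n} (e : Fin n → Carrier) → Deduplicated e
        deduplicate {zero}  e = record { size = 0 ; elem = λ () ; elem-injective = λ { {()} } ; covers = λ () }
        deduplicate {suc n} e = extend (deduplicate (e ∘ suc))
          where
          extend : Deduplicated (e ∘ suc) → Deduplicated e
          extend D with Fin.any? (λ j → Deduplicated.elem D j ≟ e zero)
          ... | yes (j , eⱼ≈e₀) = record
            { size = size ; elem = elem ; elem-injective = elem-injective
            ; covers = λ { zero → j , eⱼ≈e₀ ; (suc i) → covers i }
            }
            where open Deduplicated D
          ... | no e₀∉ = record
            { size = suc size ; elem = e zero ∷ elem ; elem-injective = injective
            ; covers = λ { zero → zero , refl ; (suc i) → Product.map suc id (covers i) }
            }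
            where
            open Deduplicated D
            injective : ∀ {i j} → (e zero ∷ elem) i ≈ (e zero ∷ elem) j → i ≡ j
            injective {zero}  {zero}  _  = ≡.refl
            injective {zero}  {suc j} eq = contradiction (j , sym eq) e₀∉
            injective {suc i} {zero}  eq = contradiction (i , eq) e₀∉
            injective {suc i} {suc j} eq = cong suc (elem-injective eq)

      enumerate : Finite → Enumeration S
      enumerate (_ , e , e-surj) = record
        { size = size ; elem = elem ; elem-injective = elem-injective
        ; surjective = λ x → let (i , eᵢ≈x) = e-surj x ; (j , eⱼ≈eᵢ) = covers i
                             in j , trans eⱼ≈eᵢ eᵢ≈x
        }
        where open Deduplicated (deduplicate e)


  module Fibres {G : Group a ℓ} {H : Group b ℓ′}
                (𝔾 : Enumeration (Group.setoid G)) (ℍ : Enumeration (Group.setoid H))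
                {φ : Group.Carrier G → Group.Carrier H}
                (φ-hom : IsMagmaHomomorphism (Group.rawMagma G) (Group.rawMagma H) φ) where
    private
      module G = Group G
      module H = Group H
    open IsMagmaHomomorphism φ-hom using (⟦⟧-cong; homo)
    open Enumeration using (size)
    open Enumeration ℍ using (δ; δ-congʳ; _≟_)
    open Enumeration 𝔾 using (elem; index; elem-index)
    open import Algebra.Properties.Group H using (identityˡ-unique)

    fibreSize : H.Carrier → ℕ
    fibreSize w = ∑[ x ∈ 𝔾 ] δ w (φ x)

    kernelSize : ℕ
    kernelSize = fibreSize H.ε

    fibreSize≡kernelSize : ∀ {w x₀} → w H.≈ φ x₀ → fibreSize w ≡ kernelSize
    fibreSize≡kernelSize {w} {x₀} w≈φx₀ = begin
      ∑[ x ∈ 𝔾 ] δ w (φ x)           ≡⟨ ∑-translate {G = G} 𝔾 (δ-congʳ w ∘ ⟦⟧-cong) x₀ ⟨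
      ∑[ y ∈ 𝔾 ] δ w (φ (y G.∙ x₀))  ≡⟨ ∑-cong 𝔾 (λ y → 𝟙-⇔ (to y) (from y) (w ≟ _) (H.ε ≟ _)) ⟩
      ∑[ y ∈ 𝔾 ] δ H.ε (φ y)         ∎
      where
      open ≡.≡-Reasoning
      φ-shift : ∀ y → φ (y G.∙ x₀) H.≈ φ y H.∙ w
      φ-shift y = H.trans (homo y x₀) (H.∙-congˡ (H.sym w≈φx₀))
      to : ∀ y → w H.≈ φ (y G.∙ x₀) → H.ε H.≈ φ y
      to y w≈ = H.sym (identityˡ-unique (φ y) w (H.sym (H.trans w≈ (φ-shift y))))
      from : ∀ y → H.ε H.≈ φ y → w H.≈ φ (y G.∙ x₀)
      from y ε≈φy = H.sym (H.trans (φ-shift y) (H.trans (H.∙-congʳ (H.sym ε≈φy)) (H.identityˡ w)))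

    fibreSize≤kernelSize : ∀ w → fibreSize w ≤ kernelSize
    fibreSize≤kernelSize w with Fin.any? (λ i → w ≟ φ (elem i))
    ... | yes (_ , w≈φx) = ≤-reflexive (fibreSize≡kernelSize w≈φx)
    ... | no w∉image     = ≤-trans (≤-reflexive empty) z≤n
      where
      w∉φ : ∀ x → ¬ w H.≈ φ x
      w∉φ x w≈φx = w∉image (index x , H.trans w≈φx (⟦⟧-cong (G.sym (elem-index x))))
      empty : fibreSize w ≡ 0
      empty = ≡.trans (∑-cong 𝔾 (λ x → 𝟙-no (w ≟ φ x) (w∉φ x)))
                      (≡.trans (∑-const 𝔾 0) (*-zeroʳ (size 𝔾)))

    size≡∑fibreSize : size 𝔾 ≡ ∑[ w ∈ ℍ ] fibreSize w
    size≡∑fibreSize = begin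
      size 𝔾                           ≡⟨ *-identityʳ (size 𝔾) ⟨
      size 𝔾 * 1                       ≡⟨ ∑-const 𝔾 1 ⟨
      ∑[ x ∈ 𝔾 ] 1                     ≡⟨ ∑-cong 𝔾 (λ x → ∑-δ₁ ℍ (φ x)) ⟨
      ∑[ x ∈ 𝔾 ] ∑[ w ∈ ℍ ] δ w (φ x)  ≡⟨ ∑-comm 𝔾 ℍ (λ x w → δ w (φ x)) ⟩
      ∑[ w ∈ ℍ ] fibreSize w           ∎
      where open ≡.≡-Reasoning

    size≤size*kernelSize : size 𝔾 ≤ size ℍ * kernelSize
    size≤size*kernelSize = begin
      size 𝔾                  ≡⟨ size≡∑fibreSize ⟩
      ∑[ w ∈ ℍ ] fibreSize w  ≤⟨ ∑-mono-≤ ℍ fibreSize≤kernelSize ⟩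
      ∑[ w ∈ ℍ ] kernelSize   ≡⟨ ∑-const ℍ kernelSize ⟩
      size ℍ * kernelSize     ∎
      where open ≤-Reasoning

    surjective⇒size≡size*kernelSize : (∀ w → ∃ λ x → w H.≈ φ x) → size 𝔾 ≡ size ℍ * kernelSize
    surjective⇒size≡size*kernelSize surj = begin
      size 𝔾                  ≡⟨ size≡∑fibreSize ⟩
      ∑[ w ∈ ℍ ] fibreSize w  ≡⟨ ∑-cong ℍ (λ w → fibreSize≡kernelSize (proj₂ (surj w))) ⟩
      ∑[ w ∈ ℍ ] kernelSize   ≡⟨ ∑-const ℍ kernelSize ⟩
      size ℍ * kernelSize     ∎
      where open ≡.≡-Reasoning

open FiniteSums

record IsDiscreteField {c ℓ : Level} (F : CommutativeRing c ℓ) : Set (c ⊔ ℓ) where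
  open CommutativeRing F
  field
    1#≉0#      : ¬ 1# ≈ 0#
    _≟_        : Decidable _≈_
    invertible : ∀ {x} → ¬ x ≈ 0# → ∃ λ y → y * x ≈ 1#

module _ {c ℓ m ℓm : Level} {F : CommutativeRing c ℓ} (M : Module F m ℓm) where
  open CommutativeRing F
  open Module M
  open import Algebra.Properties.Group +ᴹ-group using (inverseʳ-unique)
  open import Algebra.Properties.Group +-group using (x∙y⁻¹≈ε⇒x≈y)
  open import Relation.Binary.Reasoning.Setoid ≈ᴹ-setoid

  -‿distribˡ-*ₗ : ∀ a u → (- a) *ₗ u ≈ᴹ -ᴹ (a *ₗ u)
  -‿distribˡ-*ₗ a u = inverseʳ-unique (a *ₗ u) ((- a) *ₗ u) (begin
    a *ₗ u +ᴹ (- a) *ₗ u  ≈⟨ *ₗ-distribʳ u a (- a) ⟨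
    (a + - a) *ₗ u        ≈⟨ *ₗ-congʳ (-‿inverseʳ a) ⟩
    0# *ₗ u               ≈⟨ *ₗ-zeroˡ u ⟩
    0ᴹ                    ∎)

  *ₗ-cancelʳ : ∀ {u v a b} → LinIndep₂ M u v → a *ₗ u ≈ᴹ b *ₗ u → a ≈ b
  *ₗ-cancelʳ {u} {v} {a} {b} indep au≈bu = x∙y⁻¹≈ε⇒x≈y a b (proj₁ (indep (a + - b) 0# (begin
    (a + - b) *ₗ u +ᴹ 0# *ₗ v     ≈⟨ +ᴹ-cong (*ₗ-distribʳ u a (- b)) (*ₗ-zeroˡ v) ⟩
    (a *ₗ u +ᴹ (- b) *ₗ u) +ᴹ 0ᴹ  ≈⟨ +ᴹ-identityʳ _ ⟩
    a *ₗ u +ᴹ (- b) *ₗ u          ≈⟨ +ᴹ-cong au≈bu (-‿distribˡ-*ₗ b u) ⟩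
    b *ₗ u +ᴹ -ᴹ (b *ₗ u)         ≈⟨ -ᴹ‿inverseʳ (b *ₗ u) ⟩
    0ᴹ                            ∎)))

  LinIndep₂⇒∉span : ¬ 1# ≈ 0# → ∀ {u v} → LinIndep₂ M u v → ∀ a → ¬ v ≈ᴹ a *ₗ u
  LinIndep₂⇒∉span 1≉0 {u} {v} indep a v≈au = 1≉0 (proj₂ (indep (- a) 1# (begin
    (- a) *ₗ u +ᴹ 1# *ₗ v  ≈⟨ +ᴹ-cong (-‿distribˡ-*ₗ a u) (≈ᴹ-trans (*ₗ-identityˡ v) v≈au) ⟩
    -ᴹ (a *ₗ u) +ᴹ a *ₗ u  ≈⟨ -ᴹ‿inverseˡ (a *ₗ u) ⟩
    0ᴹ                     ∎)))

  module _ (isDiscreteField : IsDiscreteField F) where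
    open IsDiscreteField isDiscreteField using (_≟_; invertible)

    ∉span⇒LinIndep₂ : ∀ {u v w} → LinIndep₂ M u v → (∀ a → ¬ w ≈ᴹ a *ₗ u) → LinIndep₂ M u w
    ∉span⇒LinIndep₂ {u} {v} {w} indep w∉span a b au+bw≈0 with b ≟ 0#
    ... | yes b≈0 = proj₁ (indep a 0# (begin
      a *ₗ u +ᴹ 0# *ₗ v  ≈⟨ +ᴹ-congˡ (≈ᴹ-trans (*ₗ-zeroˡ v) (≈ᴹ-sym (*ₗ-zeroˡ w))) ⟩
      a *ₗ u +ᴹ 0# *ₗ w  ≈⟨ +ᴹ-congˡ (*ₗ-congʳ (sym b≈0)) ⟩
      a *ₗ u +ᴹ b *ₗ w   ≈⟨ au+bw≈0 ⟩
      0ᴹ                 ∎)) , b≈0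
    ... | no b≉0 = contradiction w≈-yau (w∉span (- (y * a)))
      where
      y : Carrier
      y = proj₁ (invertible b≉0)
      yau+w≈0 : (y * a) *ₗ u +ᴹ w ≈ᴹ 0ᴹ
      yau+w≈0 = begin
        (y * a) *ₗ u +ᴹ w               ≈⟨ +ᴹ-cong (*ₗ-assoc y a u) (≈ᴹ-sym (*ₗ-identityˡ w)) ⟩
        y *ₗ (a *ₗ u) +ᴹ 1# *ₗ w        ≈⟨ +ᴹ-congˡ (*ₗ-congʳ (proj₂ (invertible b≉0))) ⟨
        y *ₗ (a *ₗ u) +ᴹ (y * b) *ₗ w   ≈⟨ +ᴹ-congˡ (*ₗ-assoc y b w) ⟩
        y *ₗ (a *ₗ u) +ᴹ y *ₗ (b *ₗ w)  ≈⟨ *ₗ-distribˡ y (a *ₗ u) (b *ₗ w) ⟨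
        y *ₗ (a *ₗ u +ᴹ b *ₗ w)         ≈⟨ *ₗ-congˡ au+bw≈0 ⟩
        y *ₗ 0ᴹ                         ≈⟨ *ₗ-zeroʳ y ⟩
        0ᴹ                              ∎
      w≈-yau : w ≈ᴹ (- (y * a)) *ₗ u
      w≈-yau = ≈ᴹ-trans (inverseʳ-unique _ w yau+w≈0) (≈ᴹ-sym (-‿distribˡ-*ₗ (y * a) u))

module PrimeField {c ℓ : Level} {F : CommutativeRing c ℓ} {p : ℕ} (p-prime : Prime p) (isFp : IsFp F p) where
  open CommutativeRing F
  open IsFp isFp
  import Algebra.Properties.Semiring.Mult semiring as Mult
  open import Algebra.Properties.Ring ring using (-‿distribˡ-*; -‿involutive)
  open import Algebra.Properties.Group +-group using (identityʳ-unique; inverseʳ-unique)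
  open import Relation.Binary.Reasoning.Setoid setoid

  ι : ℕ → Carrier
  ι = natToRing F

  ι≈×1# : ∀ n → ι n ≈ n Mult.× 1#
  ι≈×1# zero    = refl
  ι≈×1# (suc n) = +-congˡ (ι≈×1# n)

  ι-+ : ∀ m n → ι (m ℕ.+ n) ≈ ι m + ι n
  ι-+ m n = trans (ι≈×1# (m ℕ.+ n)) (trans (Mult.×-homo-+ 1# m n) (sym (+-cong (ι≈×1# m) (ι≈×1# n))))

  ι-* : ∀ m n → ι (m ℕ.* n) ≈ ι m * ι n
  ι-* m n = trans (ι≈×1# (m ℕ.* n)) (trans (Mult.×1-homo-* m n) (sym (*-cong (ι≈×1# m) (ι≈×1# n))))

  ι-multiple-of-p : ∀ n → ι (n ℕ.* p) ≈ 0#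
  ι-multiple-of-p n = Equivalence.from (kernel (n ℕ.* p)) (n∣m*n n)

  1#≉0# : ¬ 1# ≈ 0#
  1#≉0# 1≈0 = ℕ.nonTrivial⇒≢1 {{prime⇒nonTrivial p-prime}}
                (∣1⇒≡1 (Equivalence.to (kernel 1) (trans (+-identityʳ 1#) 1≈0)))

  private
    ι-injective-≤ : ∀ {m n} → m ℕ.≤ n → n < p → ι m ≈ ι n → m ≡ n
    ι-injective-≤ {m} m≤n n<p ιm≈ιn with ℕₚ.m≤n⇒∃[o]m+o≡n m≤n
    ... | zero  , ≡.refl = ≡.sym (ℕₚ.+-identityʳ m)
    ... | suc d , ≡.refl = contradiction p∣1+d (>⇒∤ (ℕₚ.≤-<-trans (ℕₚ.m≤n+m (suc d) m) n<p))
      where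
      p∣1+d : p ∣ suc d
      p∣1+d = Equivalence.to (kernel (suc d))
                (identityʳ-unique (ι m) (ι (suc d)) (trans (sym (ι-+ m (suc d))) (sym ιm≈ιn)))

  ι-injective : ∀ {m n} → m < p → n < p → ι m ≈ ι n → m ≡ n
  ι-injective {m} {n} m<p n<p ιm≈ιn with ℕₚ.≤-total m n
  ... | inj₁ m≤n = ι-injective-≤ m≤n n<p ιm≈ιn
  ... | inj₂ n≤m = ≡.sym (ι-injective-≤ n≤m m<p (sym ιm≈ιn))

  enumeration : Enumeration setoid
  enumeration = record
    { size           = p
    ; elem           = ι ∘ toℕ
    ; surjective     = λ x → let (n , n<p , ιn≈x) = surjective x in
                         fromℕ< n<p , trans (reflexive (≡.cong ι (Fin.toℕ-fromℕ< n<p))) ιn≈x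
    ; elem-injective = λ {i} {j} eq → Fin.toℕ-injective (ι-injective (Fin.toℕ<n i) (Fin.toℕ<n j) eq)
    }

  invertible : ∀ {x} → ¬ x ≈ 0# → ∃ λ y → y * x ≈ 1#
  invertible {x} x≉0 with surjective x
  ... | zero , _ , ι0≈x = contradiction (sym ι0≈x) x≉0
  ... | n@(suc _) , n<p , ιn≈x with coprime-Bézout (prime⇒coprime p-prime n<p)
  ...   | Bézout.-+ a b 1+ap≡bn = ι b , (begin
    ι b * x                ≈⟨ *-congˡ ιn≈x ⟨
    ι b * ι n              ≈⟨ ι-* b n ⟨
    ι (b ℕ.* n)            ≡⟨ ≡.cong ι 1+ap≡bn ⟨
    1# + ι (a ℕ.* p)       ≈⟨ +-congˡ (ι-multiple-of-p a) ⟩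
    1# + 0#                ≈⟨ +-identityʳ 1# ⟩
    1#                     ∎)
  ...   | Bézout.+- a b 1+bn≡ap = - ι b , (begin
    - ι b * x              ≈⟨ -‿distribˡ-* (ι b) x ⟨
    - (ι b * x)            ≈⟨ -‿cong (inverseʳ-unique 1# (ι b * x) 1+bx≈0) ⟩
    - (- 1#)               ≈⟨ -‿involutive 1# ⟩
    1#                     ∎)
    where
    1+bx≈0 : 1# + ι b * x ≈ 0#
    1+bx≈0 = begin
      1# + ι b * x         ≈⟨ +-congˡ (*-congˡ ιn≈x) ⟨
      1# + ι b * ι n       ≈⟨ +-congˡ (ι-* b n) ⟨
      ι (1 ℕ.+ b ℕ.* n)    ≡⟨ ≡.cong ι 1+bn≡ap ⟩
      ι (a ℕ.* p)          ≈⟨ ι-multiple-of-p a ⟩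
      0#                   ∎

  isDiscreteField : IsDiscreteField F
  isDiscreteField = record { 1#≉0# = 1#≉0# ; _≟_ = Enumeration._≟_ enumeration ; invertible = invertible }

module Bilinear
  {c ℓ m ℓm n ℓn : Level} {F : CommutativeRing c ℓ} {V : Module F m ℓm} {W : Module F n ℓn}
  {β : Module.Carrierᴹ V → Module.Carrierᴹ V → Module.Carrierᴹ W} (bilinear : IsBilinear V W β) where
  private
    module F = CommutativeRing F
    module V = Module V
    module W = Module W
  open IsBilinear bilinear

  β-zeroʳ : ∀ u {z} → z V.≈ᴹ V.0ᴹ → β u z W.≈ᴹ W.0ᴹ
  β-zeroʳ u {z} z≈0 = W.≈ᴹ-trans (cong V.≈ᴹ-refl (V.≈ᴹ-trans z≈0 (V.≈ᴹ-sym (V.*ₗ-zeroˡ V.0ᴹ))))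
                                 (W.≈ᴹ-trans (*-right F.0# u V.0ᴹ) (W.*ₗ-zeroˡ (β u V.0ᴹ)))

  β-homʳ : ∀ u → IsMagmaHomomorphism V.+ᴹ-rawMagma W.+ᴹ-rawMagma (β u)
  β-homʳ u = record { isRelHomomorphism = record { cong = cong V.≈ᴹ-refl } ; homo = +-right u }

  β-homˡ : ∀ z → IsMagmaHomomorphism V.+ᴹ-rawMagma W.+ᴹ-rawMagma (λ v → β v z)
  β-homˡ z = record
    { isRelHomomorphism = record { cong = λ u≈u′ → cong u≈u′ V.≈ᴹ-refl }
    ; homo = λ u u′ → +-left u u′ z
    }

  β-pair-hom : ∀ u u′ → IsMagmaHomomorphism V.+ᴹ-rawMagma (Group.rawMagma (W.+ᴹ-group ×ᴳ W.+ᴹ-group))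
                                             (λ z → β u z , β u′ z)
  β-pair-hom u u′ = record
    { isRelHomomorphism = record { cong = λ z≈z′ → cong V.≈ᴹ-refl z≈z′ , cong V.≈ᴹ-refl z≈z′ }
    ; homo = λ z z′ → +-right u z z′ , +-right u′ z z′
    }

module DoubleCounting
  {f ℓ m ℓm n ℓn : Level} {p : ℕ} (p-prime : Prime p) {F : CommutativeRing f ℓ} (isFp : IsFp F p)
  {V : Module F m ℓm} {W : Module F n ℓn}
  {β : Module.Carrierᴹ V → Module.Carrierᴹ V → Module.Carrierᴹ W} (bilinear : IsBilinear V W β)
  (𝕍 : Enumeration (Module.≈ᴹ-setoid V)) (𝕎 : Enumeration (Module.≈ᴹ-setoid W))
  {v₁ v₂ : Module.Carrierᴹ V} (v-indep : LinIndep₂ V v₁ v₂)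
  {w₁ w₂ : Module.Carrierᴹ W} (w-indep : LinIndep₂ W w₁ w₂)
  (ψ : Psi V W β) where
  open import Data.Nat.Base using (_+_; _*_)
  open import Data.Nat.Properties
    using ( _≟_; +-monoʳ-≤; *-monoʳ-≤; +-identityʳ; *-identityˡ; *-identityʳ; *-assoc; *-comm; m≤m+n; m≤n*m
          ; ≤-reflexive; ≤-trans; <⇒≱; +-cancelˡ-≤; *-cancelˡ-≡; *-cancelˡ-≤; *-cancelʳ-≤; suc-pred
          ; *-commutativeSemigroup; module ≤-Reasoning)
  open import Algebra.Properties.CommutativeSemigroup *-commutativeSemigroup using (x∙yz≈y∙xz)
  private
    module V = Module V
    module W = Module W
  open IsBilinear bilinear using (cong)
  open Bilinear bilinear
  open PrimeField p-prime isFp using (isDiscreteField; 1#≉0#) renaming (enumeration to 𝔽)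
  open Enumeration using (size; elem; injective⇒≤size)
  open Enumeration 𝕍 using () renaming (δ to δᵛ; _≟_ to _≟ᵛ_)
  open Enumeration 𝕎 using () renaming (δ to δʷ; _≟_ to _≟ʷ_)

  N M : ℕ
  N = size 𝕍
  M = size 𝕎

  κ : V.Carrierᴹ → ℕ
  κ z = δʷ W.0ᴹ (β v₁ z)

  k : ℕ
  k = ∑[ z ∈ 𝕍 ] κ z

  c : V.Carrierᴹ → ℕ
  c z = ∑[ v ∈ 𝕍 ] δʷ W.0ᴹ (β v z)

  r : V.Carrierᴹ → ℕ
  r v = ∑[ z ∈ 𝕍 ] (κ z * δʷ W.0ᴹ (β v z))

  s : V.Carrierᴹ → ℕ
  s v = ∑[ a ∈ 𝔽 ] δᵛ v (a V.*ₗ v₁)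

  N≡M*k : N ≡ M * k
  N≡M*k = Fibres.surjective⇒size≡size*kernelSize {G = V.+ᴹ-group} {H = W.+ᴹ-group} 𝕍 𝕎 (β-homʳ v₁)
            λ w → let (z , β₁z≈w , _) = ψ v₁ v₂ v-indep w w in z , W.≈ᴹ-sym β₁z≈w

  p<M : p < M
  p<M = injective⇒≤size 𝕎 g g-injective
    where
    g : Fin (suc p) → W.Carrierᴹ
    g zero    = w₂
    g (suc i) = elem 𝔽 i W.*ₗ w₁
    g-injective : ∀ {i j} → g i W.≈ᴹ g j → i ≡ j
    g-injective {zero}  {zero}  _  = ≡.refl
    g-injective {zero}  {suc j} eq = contradiction eq (LinIndep₂⇒∉span W 1#≉0# w-indep _)
    g-injective {suc i} {zero}  eq = contradiction (W.≈ᴹ-sym eq) (LinIndep₂⇒∉span W 1#≉0# w-indep _)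
    g-injective {suc i} {suc j} eq = ≡.cong suc (Enumeration.elem-injective 𝔽 (*ₗ-cancelʳ W w-indep eq))

  M-nonZero : NonZero M
  M-nonZero = >-nonZero (≤-trans (s≤s z≤n) p<M)

  M′ : ℕ
  M′ = ℕ.pred M

  M≡1+M′ : M ≡ suc M′
  M≡1+M′ = ≡.sym (suc-pred M {{M-nonZero}})

  N≤M*c : ∀ z → N ≤ M * c z
  N≤M*c z = Fibres.size≤size*kernelSize {G = V.+ᴹ-group} {H = W.+ᴹ-group} 𝕍 𝕎 (β-homˡ z)

  k≡M*r : ∀ {v} → LinIndep₂ V v₁ v → k ≡ M * r v
  k≡M*r {v} indep = *-cancelˡ-≡ k (M * r v) M {{M-nonZero}} (begin
    M * k                  ≡⟨ N≡M*k ⟨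
    N                      ≡⟨ N≡M*M*kernelSize ⟩
    M * M * kernelSize     ≡⟨ *-assoc M M kernelSize ⟩
    M * (M * kernelSize)   ≡⟨ ≡.cong (λ t → M * (M * t)) kernelSize≡r ⟩
    M * (M * r v)          ∎)
    where
    open ≡.≡-Reasoning
    open Fibres {G = V.+ᴹ-group} {H = W.+ᴹ-group ×ᴳ W.+ᴹ-group} 𝕍 (𝕎 ×ₑ 𝕎) (β-pair-hom v₁ v)
      using (kernelSize; surjective⇒size≡size*kernelSize)
    N≡M*M*kernelSize : N ≡ M * M * kernelSize
    N≡M*M*kernelSize = surjective⇒size≡size*kernelSize λ (w , w′) →
      let (z , β₁z≈w , βz≈w′) = ψ v₁ v indep w w′ in z , W.≈ᴹ-sym β₁z≈w , W.≈ᴹ-sym βz≈w′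
    kernelSize≡r : kernelSize ≡ r v
    kernelSize≡r = ∑-cong 𝕍 λ z → δ-×ₑ 𝕎 𝕎 W.0ᴹ W.0ᴹ (β v₁ z) (β v z)

  r≤k : ∀ v → r v ≤ k
  r≤k v = ∑-mono-≤ 𝕍 λ z →
    ≤-trans (*-monoʳ-≤ (κ z) (𝟙≤1 (W.0ᴹ ≟ʷ β v z))) (≤-reflexive (*-identityʳ (κ z)))

  κ≡1 : ∀ {z} → z V.≈ᴹ V.0ᴹ → κ z ≡ 1
  κ≡1 {z} z≈0 = 𝟙-yes (W.0ᴹ ≟ʷ β v₁ z) (W.≈ᴹ-sym (β-zeroʳ v₁ z≈0))

  c≡N : ∀ {z} → z V.≈ᴹ V.0ᴹ → c z ≡ N
  c≡N {z} z≈0 = ≡.trans (∑-cong 𝕍 λ v → 𝟙-yes (W.0ᴹ ≟ʷ β v z) (W.≈ᴹ-sym (β-zeroʳ v z≈0)))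
                        (≡.trans (∑-const 𝕍 1) (*-identityʳ N))

  1≤k : 1 ≤ k
  1≤k = ≤-trans (≤-reflexive (≡.sym (κ≡1 V.≈ᴹ-refl)))
                (∑-term 𝕍 (λ z≈z′ → Enumeration.δ-congʳ 𝕎 W.0ᴹ (cong V.≈ᴹ-refl z≈z′)) V.0ᴹ)

  ∑r≡∑κc : ∑[ v ∈ 𝕍 ] r v ≡ ∑[ z ∈ 𝕍 ] (κ z * c z)
  ∑r≡∑κc = ≡.trans (∑-comm 𝕍 𝕍 λ v z → κ z * δʷ W.0ᴹ (β v z))
                   (∑-cong 𝕍 λ z → ≡.sym (*-distribˡ-∑ 𝕍 (κ z) λ v → δʷ W.0ᴹ (β v z)))

  ∑s≡p : ∑[ v ∈ 𝕍 ] s v ≡ p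
  ∑s≡p = begin
    ∑[ v ∈ 𝕍 ] ∑[ a ∈ 𝔽 ] δᵛ v (a V.*ₗ v₁)  ≡⟨ ∑-comm 𝕍 𝔽 (λ v a → δᵛ v (a V.*ₗ v₁)) ⟩
    ∑[ a ∈ 𝔽 ] ∑[ v ∈ 𝕍 ] δᵛ v (a V.*ₗ v₁)  ≡⟨ ∑-cong 𝔽 (λ a → ∑-δ₁ 𝕍 (a V.*ₗ v₁)) ⟩
    ∑[ a ∈ 𝔽 ] 1                          ≡⟨ ∑-const 𝔽 1 ⟩
    p * 1                                 ≡⟨ *-identityʳ p ⟩
    p                                     ∎
    where open ≡.≡-Reasoning

  s≡0⇒LinIndep₂ : ∀ {v} → s v ≡ 0 → LinIndep₂ V v₁ v
  s≡0⇒LinIndep₂ {v} s≡0 = ∉span⇒LinIndep₂ V isDiscreteField v-indep λ a v≈av₁ →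
    contradiction (begin
      1                     ≡⟨ 𝟙-yes (v ≟ᵛ (a V.*ₗ v₁)) v≈av₁ ⟨
      δᵛ v (a V.*ₗ v₁)      ≤⟨ ∑-term 𝔽 (λ a≈b → Enumeration.δ-congʳ 𝕍 v (V.*ₗ-congʳ a≈b)) a ⟩
      s v                   ≡⟨ s≡0 ⟩
      0                     ∎) λ ()
    where open ≤-Reasoning

  lower-pointwise : ∀ z → κ z * N + δᵛ z V.0ᴹ * (M′ * N) ≤ M * (κ z * c z)
  lower-pointwise z with z ≟ᵛ V.0ᴹ
  ... | yes z≈0 = ≤-reflexive (begin
    κ z * N + δᵛ z V.0ᴹ * (M′ * N)
      ≡⟨ ≡.cong₂ (λ a b → a * N + b * (M′ * N)) (κ≡1 z≈0) (𝟙-yes (z ≟ᵛ V.0ᴹ) z≈0) ⟩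
    1 * N + 1 * (M′ * N)
      ≡⟨ ≡.cong₂ _+_ (*-identityˡ N) (*-identityˡ (M′ * N)) ⟩
    suc M′ * N
      ≡⟨ ≡.cong (_* N) M≡1+M′ ⟨
    M * N
      ≡⟨ ≡.cong (M *_) (≡.trans (≡.cong₂ _*_ (κ≡1 z≈0) (c≡N z≈0)) (*-identityˡ N)) ⟨
    M * (κ z * c z)
      ∎)
    where open ≡.≡-Reasoning
  ... | no z≉0 = begin
    κ z * N + δᵛ z V.0ᴹ * (M′ * N)  ≡⟨ ≡.cong (λ b → κ z * N + b * _) (𝟙-no (z ≟ᵛ V.0ᴹ) z≉0) ⟩
    κ z * N + 0                    ≡⟨ +-identityʳ (κ z * N) ⟩
    κ z * N                        ≤⟨ *-monoʳ-≤ (κ z) (N≤M*c z) ⟩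
    κ z * (M * c z)                ≡⟨ x∙yz≈y∙xz (κ z) M (c z) ⟩
    M * (κ z * c z)                ∎
    where open ≤-Reasoning

  upper-pointwise : ∀ v → M * r v ≤ k + s v * (M′ * k)
  upper-pointwise v with s v ≟ 0
  ... | yes s≡0 = begin
    M * r v               ≡⟨ k≡M*r (s≡0⇒LinIndep₂ s≡0) ⟨
    k                     ≤⟨ m≤m+n k _ ⟩
    k + s v * (M′ * k)    ∎
    where open ≤-Reasoning
  ... | no s≢0 = begin
    M * r v               ≤⟨ *-monoʳ-≤ M (r≤k v) ⟩
    M * k                 ≡⟨ ≡.cong (_* k) M≡1+M′ ⟩
    k + M′ * k            ≤⟨ +-monoʳ-≤ k (m≤n*m (M′ * k) (s v) {{≢-nonZero s≢0}}) ⟩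
    k + s v * (M′ * k)    ∎
    where open ≤-Reasoning

  lower : k * N + M′ * N ≤ M * ∑[ z ∈ 𝕍 ] (κ z * c z)
  lower = begin
    k * N + M′ * N
      ≡⟨ ≡.cong (k * N +_) (*-identityˡ (M′ * N)) ⟨
    k * N + 1 * (M′ * N)
      ≡⟨ ≡.cong (λ t → k * N + t * (M′ * N)) (∑-δ₁ 𝕍 V.0ᴹ) ⟨
    k * N + (∑[ z ∈ 𝕍 ] δᵛ z V.0ᴹ) * (M′ * N)
      ≡⟨ ≡.cong₂ _+_ (*-distribʳ-∑ 𝕍 N κ) (*-distribʳ-∑ 𝕍 (M′ * N) (λ z → δᵛ z V.0ᴹ)) ⟩
    ∑[ z ∈ 𝕍 ] (κ z * N) + ∑[ z ∈ 𝕍 ] (δᵛ z V.0ᴹ * (M′ * N))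
      ≡⟨ ∑-distrib-+ 𝕍 (λ z → κ z * N) (λ z → δᵛ z V.0ᴹ * (M′ * N)) ⟨
    ∑[ z ∈ 𝕍 ] (κ z * N + δᵛ z V.0ᴹ * (M′ * N))
      ≤⟨ ∑-mono-≤ 𝕍 lower-pointwise ⟩
    ∑[ z ∈ 𝕍 ] (M * (κ z * c z))
      ≡⟨ *-distribˡ-∑ 𝕍 M (λ z → κ z * c z) ⟨
    M * ∑[ z ∈ 𝕍 ] (κ z * c z)
      ∎
    where open ≤-Reasoning

  upper : M * ∑[ v ∈ 𝕍 ] r v ≤ N * k + p * (M′ * k)
  upper = begin
    M * ∑[ v ∈ 𝕍 ] r v
      ≡⟨ *-distribˡ-∑ 𝕍 M r ⟩
    ∑[ v ∈ 𝕍 ] (M * r v)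
      ≤⟨ ∑-mono-≤ 𝕍 upper-pointwise ⟩
    ∑[ v ∈ 𝕍 ] (k + s v * (M′ * k))
      ≡⟨ ∑-distrib-+ 𝕍 (λ _ → k) (λ v → s v * (M′ * k)) ⟩
    ∑[ v ∈ 𝕍 ] k + ∑[ v ∈ 𝕍 ] (s v * (M′ * k))
      ≡⟨ ≡.cong₂ _+_ (∑-const 𝕍 k) (≡.sym (*-distribʳ-∑ 𝕍 (M′ * k) s)) ⟩
    N * k + (∑[ v ∈ 𝕍 ] s v) * (M′ * k)
      ≡⟨ ≡.cong (λ t → N * k + t * (M′ * k)) ∑s≡p ⟩
    N * k + p * (M′ * k)
      ∎
    where open ≤-Reasoning

  absurd : ⊥
  absurd = <⇒≱ p<M M≤p
    where
    open ≤-Reasoning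
    M′-nonZero : NonZero M′
    M′-nonZero = >-nonZero (≤-trans (>-nonZero⁻¹ p {{prime⇒nonZero p-prime}})
                                    (ℕ.s≤s⁻¹ (≡.subst (p <_) M≡1+M′ p<M)))
    M′*N≤M′*[p*k] : M′ * N ≤ M′ * (p * k)
    M′*N≤M′*[p*k] = +-cancelˡ-≤ (k * N) _ _ (begin
      k * N + M′ * N              ≤⟨ lower ⟩
      M * ∑[ z ∈ 𝕍 ] (κ z * c z)  ≡⟨ ≡.cong (M *_) ∑r≡∑κc ⟨
      M * ∑[ v ∈ 𝕍 ] r v          ≤⟨ upper ⟩
      N * k + p * (M′ * k)        ≡⟨ ≡.cong₂ _+_ (*-comm N k) (x∙yz≈y∙xz p M′ k) ⟩
      k * N + M′ * (p * k)        ∎)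
    M≤p : M ≤ p
    M≤p = *-cancelʳ-≤ M p k {{>-nonZero 1≤k}} (begin
      M * k  ≡⟨ N≡M*k ⟨
      N      ≤⟨ *-cancelˡ-≤ M′ {{M′-nonZero}} M′*N≤M′*[p*k] ⟩
      p * k  ∎)

-- Equality in a finite module is decidable only classically, but as the goal is ⊥ we may assume it.
lemma2p6 : ∀ {c ℓ m ℓm n ℓn : Level} (p : ℕ) → Prime p → p ≢ 2 →
    (F : CommutativeRing c ℓ) → IsFp F p →
    (V : Module F m ℓm) (W : Module F n ℓn)
    (β : Module.Carrierᴹ V → Module.Carrierᴹ V → Module.Carrierᴹ W) →
    DimAtLeast2 V → DimAtLeast2 W → IsBilinear V W β →
    FiniteModule V → FiniteModule W →
    ¬ Psi V W β
lemma2p6 p p-prime _ F isFp V W β (_ , _ , v-indep) (_ , _ , w-indep) bilinear V-finite W-finite ψ =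
  finite⇒¬¬decidable {S = Module.≈ᴹ-setoid V} V-finite λ _≟ᵛ_ →
  finite⇒¬¬decidable {S = Module.≈ᴹ-setoid W} W-finite λ _≟ʷ_ →
  DoubleCounting.absurd p-prime isFp bilinear (enumerate _≟ᵛ_ V-finite) (enumerate _≟ʷ_ W-finite)
                        v-indep w-indep ψ
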